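{- Let $a_1,a_2,\dotsc$ be a sequence in a semigroup $S$ such that the set $\mathrm{FS}(a_1,a_2,\dotsc)$ is infinite. Then $\mathrm{FS}(a_1,a_2,\dotsc)$ (and hence every superset of it) is a proper IP set.
   Context: Semigroups are written additively. For nonempty finite $F=\{i_1<\dotsb<i_m\}\subseteq\mathbb{N}$, $a_F:=a_{i_1}+\dotsb+a_{i_m}$, and $\mathrm{FS}(a_1,a_2,\dotsc):=\{a_F: F\text{ finite nonempty}\}$. A proper IP set in $S$ is a subset of $S$ containing $\mathrm{FS}(b_1,b_2,\dotsc)$ for some bijective (injective) sequence $b_1,b_2,\dotsc$ in $S$. -}

module Defs where

open import Level using (_⊔_)
open import Algebra.Bundles using (Semigroup)
open import Data.Nat using (ℕ; _<_)
open import Data.Product using (Σ; ∃; _×_)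
open import Data.List using (List)
open import Data.List.NonEmpty using (List⁺; toList; foldr₁; map)
open import Data.List.Relation.Unary.All using (All)
open import Data.List.Relation.Unary.AllPairs using (AllPairs)
open import Function.Definitions using (Injective)
open import Relation.Binary.PropositionalEquality using (_≡_)
open import Relation.Nullary using (¬_)

module _ {c ℓ} (S : Semigroup c ℓ) where
  open Semigroup S

  -- A nonempty finite index set F = {i₁ < … < i_m} ⊆ ℕ, given as a
  -- nonempty list that is strictly increasing.
  StrictlyIncreasing : List⁺ ℕ → Set
  StrictlyIncreasing F = AllPairs _<_ (toList F)

  sumOver : (ℕ → Carrier) → List⁺ ℕ → Carrier
  sumOver a F = foldr₁ _∙_ (map a F)

  InFS : (ℕ → Carrier) → Carrier → Set ℓ
  InFS a x = Σ (List⁺ ℕ) (λ F → StrictlyIncreasing F × sumOver a F ≈ x)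

  FSInfinite : (ℕ → Carrier) → Set (c ⊔ ℓ)
  FSInfinite a = (xs : List Carrier) →
    ∃ (λ x → InFS a x × All (λ y → ¬ (x ≈ y)) xs)

  ProperIPSet : ∀ {p} → (Carrier → Set p) → Set (c ⊔ ℓ ⊔ p)
  ProperIPSet A =
    ∃ (λ (b : ℕ → Carrier) → Injective _≡_ _≈_ b × (∀ x → InFS b x → A x))

-- An element of FS(a) is a₀, or a₀ + y, or y, for some y ∈ FS(a₁,a₂,…); hence
-- every tail of a still has infinite FS.  Choose inductively a finite block
-- Hₙ of indices, lying beyond all earlier blocks, with bₙ := a_{Hₙ} different
-- from b₀,…,bₙ₋₁: this is possible because the FS of the remaining tail is
-- infinite.  Then b is injective, and b_F = a_{⋃_{n∈F} Hₙ} ∈ FS(a).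
module Submission where

open import Defs
open import Algebra.Bundles using (Semigroup)
open import Level using (_⊔_)
open import Data.Nat using (ℕ; zero; suc; _+_; _≤_; _<_; z≤n; s≤s; s≤s⁻¹; z<s)
open import Data.Nat.Properties using (<-≤-trans; <-trans; <-cmp; m≤n⇒m<n∨m≡n; m≤m+n; +-monoʳ-<)
open import Data.List.Extrema.Nat using (max; xs≤max)
open import Data.Product using (∃; _×_; _,_)
open import Data.Sum using (_⊎_; inj₁; inj₂)
open import Data.List using (List; []; _∷_; _++_)
import Data.List as List
open import Data.List.NonEmpty using (List⁺; _∷_; toList; map; _⁺++⁺_)
open import Data.List.Membership.Propositional using (_∈_)
open import Data.List.Relation.Unary.Any using (here; there)
open import Data.List.Relation.Unary.All using (All; []; _∷_)
import Data.List.Relation.Unary.All as All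
import Data.List.Relation.Unary.All.Properties as All
open import Data.List.Relation.Unary.AllPairs using (AllPairs; []; _∷_)
import Data.List.Relation.Unary.AllPairs as AllPairs
import Data.List.Relation.Unary.AllPairs.Properties as AllPairs
open import Function using (_∘_)
open import Function.Definitions using (Injective)
open import Relation.Binary using (tri<; tri≈; tri>)
open import Relation.Binary.PropositionalEquality as ≡ using (_≡_)
open import Relation.Nullary using (¬_; contradiction)

module _ {c ℓ} (S : Semigroup c ℓ) where
  open Semigroup S

  shift : ℕ → (ℕ → Carrier) → ℕ → Carrier
  shift k a i = a (k + i)

  sumOver-map : ∀ (a : ℕ → Carrier) σ F → sumOver S a (map σ F) ≡ sumOver S (a ∘ σ) F
  sumOver-map a σ (i ∷ is) = go i is
    where
    go : ∀ i is → sumOver S a (map σ (i ∷ is)) ≡ sumOver S (a ∘ σ) (i ∷ is)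
    go i []       = ≡.refl
    go i (j ∷ js) = ≡.cong (a (σ i) ∙_) (go j js)

  sumOver-⁺++⁺ : ∀ (a : ℕ → Carrier) F G → sumOver S a (F ⁺++⁺ G) ≈ sumOver S a F ∙ sumOver S a G
  sumOver-⁺++⁺ a (i ∷ is) G = go i is
    where
    go : ∀ i is → sumOver S a ((i ∷ is) ⁺++⁺ G) ≈ sumOver S a (i ∷ is) ∙ sumOver S a G
    go i []       = refl
    go i (k ∷ ks) = trans (∙-congˡ (go k ks)) (sym (assoc _ _ _))

  InFS-resp-≈ : ∀ {a x y} → x ≈ y → InFS S a x → InFS S a y
  InFS-resp-≈ x≈y (F , F↑ , aF≈x) = F , F↑ , trans aF≈x x≈y

  InFS-reindex : ∀ {a x} σ → (∀ {i j} → i < j → σ i < σ j) →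
                 InFS S (a ∘ σ) x → InFS S a x
  InFS-reindex {a} σ σ-mono (F , F↑ , aσF≈x) =
    map σ F , AllPairs.map⁺ (AllPairs.map σ-mono F↑) ,
    trans (reflexive (sumOver-map a σ F)) aσF≈x

  InFS-shift : ∀ {a x} k → InFS S (shift k a) x → InFS S a x
  InFS-shift k = InFS-reindex (k +_) (+-monoʳ-< k)

  InFS-∙-shift : ∀ {a y} k F → StrictlyIncreasing S F → All (_< k) (toList F) →
                 InFS S (shift k a) y → InFS S a (sumOver S a F ∙ y)
  InFS-∙-shift {a} k F F↑ F<k (G , G↑ , aG≈y) =
    F ⁺++⁺ map (k +_) G ,
    AllPairs.++⁺ F↑ kG↑ (All.map (λ i<k → All.map⁺ (All.universal (λ j → <-≤-trans i<k (m≤m+n k j)) _)) F<k) ,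
    trans (sumOver-⁺++⁺ a F (map (k +_) G))
          (∙-congˡ (trans (reflexive (sumOver-map a (k +_) G)) aG≈y))
    where kG↑ : StrictlyIncreasing S (map (k +_) G)
          kG↑ = AllPairs.map⁺ (AllPairs.map (+-monoʳ-< k) G↑)

  positive⇒map-suc : ∀ {is} → All (0 <_) is → ∃ λ js → is ≡ List.map suc js
  positive⇒map-suc {[]}         []          = [] , ≡.refl
  positive⇒map-suc {suc i ∷ is} (_ ∷ is>0) with positive⇒map-suc is>0
  ... | js , ≡.refl = i ∷ js , ≡.refl

  InFS-unsuc : ∀ {a} F → StrictlyIncreasing S F → All (0 <_) (toList F) →
               InFS S (a ∘ suc) (sumOver S a F)
  InFS-unsuc {a} (suc i ∷ is) F↑ (_ ∷ is>0) with positive⇒map-suc is>0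
  ... | js , ≡.refl =
    i ∷ js , AllPairs.map s≤s⁻¹ (AllPairs.map⁻ F↑) , reflexive (≡.sym (sumOver-map a suc (i ∷ js)))

  InFS-uncons : ∀ {a x} → InFS S a x →
                x ≈ a 0 ⊎ ∃ λ y → InFS S (a ∘ suc) y × (x ≈ y ⊎ x ≈ a 0 ∙ y)
  InFS-uncons ((0 ∷ [])     , _               , a0≈x) = inj₁ (sym a0≈x)
  InFS-uncons ((0 ∷ j ∷ js) , (0<js ∷ js↑)    , aF≈x) =
    inj₂ (_ , InFS-unsuc (j ∷ js) js↑ 0<js , inj₂ (sym aF≈x))
  InFS-uncons ((suc i ∷ is) , F↑@(i<is ∷ _) , aF≈x) =
    inj₂ (_ , InFS-unsuc (suc i ∷ is) F↑ (z<s ∷ All.map (<-trans z<s) i<is) , inj₁ (sym aF≈x))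

  FSInfinite-suc : ∀ {a} → FSInfinite S a → FSInfinite S (a ∘ suc)
  FSInfinite-suc {a} FS∞ xs with FS∞ (a 0 ∷ xs ++ List.map (a 0 ∙_) xs)
  ... | x , x∈FS , (x≉a0 ∷ x∉) with All.++⁻ xs x∉ | InFS-uncons x∈FS
  ... | _    , _       | inj₁ x≈a0                     = contradiction x≈a0 x≉a0
  ... | x∉xs , _       | inj₂ (y , y∈FS , inj₁ x≈y)    =
    y , y∈FS , All.map (λ x≉z y≈z → x≉z (trans x≈y y≈z)) x∉xs
  ... | _    , x∉a0xs  | inj₂ (y , y∈FS , inj₂ x≈a0y)  =
    y , y∈FS , All.map (λ x≉a0z y≈z → x≉a0z (trans x≈a0y (∙-congˡ y≈z))) (All.map⁻ x∉a0xs)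

  FSInfinite-shift : ∀ {a} k → FSInfinite S a → FSInfinite S (shift k a)
  FSInfinite-shift zero    FS∞ = FS∞
  FSInfinite-shift (suc k) FS∞ = FSInfinite-shift k (FSInfinite-suc FS∞)

  record FreshBlock (a : ℕ → Carrier) (avoid : List Carrier) : Set (c ⊔ ℓ) where
    field
      value    : Carrier
      value∈FS : InFS S a value
      fresh    : All (λ y → ¬ value ≈ y) avoid
      gap      : ℕ
      value∙FS : ∀ {y} → InFS S (shift gap a) y → InFS S a (value ∙ y)

  freshBlock : ∀ {a} → FSInfinite S a → ∀ avoid → FreshBlock a avoid
  freshBlock FS∞ avoid with FS∞ avoid
  ... | x , x∈@(F , F↑ , aF≈x) , x∉ = record
    { value    = x
    ; value∈FS = x∈
    ; fresh    = x∉
    ; gap      = suc (max 0 (toList F))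
    ; value∙FS = λ y∈ → InFS-resp-≈ (∙-congʳ aF≈x)
                  (InFS-∙-shift _ F F↑ (All.map s≤s (xs≤max 0 (toList F))) y∈)
    }

  -- tₙ plays the role of the tail of a from which the n-th block bₙ is drawn.
  module _ (t : ℕ → ℕ → Carrier) (b : ℕ → Carrier)
           (FS-decreasing : ∀ n {y} → InFS S (t (suc n)) y → InFS S (t n) y)
           (b∈ : ∀ n → InFS S (t n) (b n))
           (b∙ : ∀ n {y} → InFS S (t (suc n)) y → InFS S (t n) (b n ∙ y))
           where

    FS-antitone : ∀ {m n y} → m ≤ n → InFS S (t n) y → InFS S (t m) y
    FS-antitone {m} {zero}  z≤n y∈ = y∈
    FS-antitone {m} {suc n} m≤n y∈ with m≤n⇒m<n∨m≡n m≤n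
    ... | inj₂ ≡.refl    = y∈
    ... | inj₁ (s≤s m≤n) = FS-antitone m≤n (FS-decreasing n y∈)

    InFS-sumOver : ∀ F → StrictlyIncreasing S F → InFS S (t (List⁺.head F)) (sumOver S b F)
    InFS-sumOver (i ∷ [])     _                 = b∈ i
    InFS-sumOver (i ∷ j ∷ js) ((i<j ∷ _) ∷ js↑) = b∙ i (FS-antitone i<j (InFS-sumOver (j ∷ js) js↑))

    InFS-blocks : ∀ {x} → InFS S b x → InFS S (t 0) x
    InFS-blocks (F , F↑ , bF≈x) = InFS-resp-≈ bF≈x (FS-antitone z≤n (InFS-sumOver F F↑))

  earlier-distinct⇒injective : ∀ (b : ℕ → Carrier) →
    (∀ {m n} → m < n → ¬ b n ≈ b m) → Injective _≡_ _≈_ b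
  earlier-distinct⇒injective b distinct {m} {n} bm≈bn with <-cmp m n
  ... | tri< m<n _ _ = contradiction (sym bm≈bn) (distinct m<n)
  ... | tri≈ _ m≡n _ = m≡n
  ... | tri> _ _ n<m = contradiction bm≈bn (distinct n<m)

  module FreshBlocks {a : ℕ → Carrier} (FS∞ : FSInfinite S a) where

    record Stage : Set (c ⊔ ℓ) where
      constructor stage
      field
        remaining  : ℕ → Carrier
        remaining∞ : FSInfinite S remaining
        chosen     : List Carrier

      block : FreshBlock remaining chosen
      block = freshBlock remaining∞ chosen

    open Stage
    open FreshBlock

    stages : ℕ → Stage
    stages zero    = stage a FS∞ []
    stages (suc n) = stage (shift (gap B) (remaining s)) (FSInfinite-shift (gap B) (remaining∞ s))
                           (value B ∷ chosen s)
      where s = stages n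
            B = block s

    b : ℕ → Carrier
    b n = value (block (stages n))

    b∈chosen : ∀ {m n} → m < n → b m ∈ chosen (stages n)
    b∈chosen {m} {suc n} (s≤s m≤n) with m≤n⇒m<n∨m≡n m≤n
    ... | inj₁ m<n    = there (b∈chosen m<n)
    ... | inj₂ ≡.refl = here ≡.refl

    b-injective : Injective _≡_ _≈_ b
    b-injective = earlier-distinct⇒injective b
      (λ {_} {n} m<n → All.lookup (fresh (block (stages n))) (b∈chosen m<n))

    FS[b]⊆FS[a] : ∀ {x} → InFS S b x → InFS S a x
    FS[b]⊆FS[a] = InFS-blocks (remaining ∘ stages) b
      (λ n → InFS-shift (gap (block (stages n))))
      (λ n → value∈FS (block (stages n)))
      (λ n → value∙FS (block (stages n)))

lemma1p3 : ∀ {c ℓ} (S : Semigroup c ℓ) (a : ℕ → Semigroup.Carrier S) →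
    FSInfinite S a → ProperIPSet S (InFS S a)
lemma1p3 S a FS∞ = b , b-injective , λ _ → FS[b]⊆FS[a]
  where open FreshBlocks S FS∞
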